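{- Let $N=\{p_1,\dots,p_n\}$ be a finite set of propositional variables and let $t\subseteq 2^N$ be a nonempty $N$-team. For each $v\in 2^N$ let $\iota_v$ be the inclusion atom $x_1\dots x_n\subseteq p_1\dots p_n$ where $x_i=\top$ if $v(p_i)=1$ and $x_i=\bot$ if $v(p_i)=0$, and let $\sigma_t=\bigvee_{v\in 2^N\setminus t}\iota_v$ (local disjunction). Then for every $N$-team $s$: $s\models\sigma_t$ iff ($s\not\subseteq t$ or $s=\emptyset$).
   Context: An $N$-team is a set of valuations $v:N\to\{0,1\}$. Team semantics: $s\models\phi\vee\psi$ iff there are $r,r'\subseteq s$ with $s=r\cup r'$, $r\models\phi$, $r'\models\psi$; $s\models\bot$ iff $s=\emptyset$; $s\models a_1\dots a_m\subseteq b_1\dots b_m$ iff for every $v\in s$ there is $u\in s$ with $v(a_i)=u(b_i)$ for all $i$, where $v(\top)=1$ and $v(\bot)=0$ for every valuation. (Thus for nonempty $s$, $s\models\iota_v$ iff $v\in s$.) An empty disjunction is read as $\bot$. -}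

module Defs where

open import Data.Nat using (ℕ; zero; suc)
open import Data.Fin using (Fin)
open import Data.Bool using (Bool; true; false; T; not)
open import Data.Vec using (Vec; []; _∷_; lookup; tabulate)
open import Data.List using (List; []; _∷_; _++_; map; filter; foldr)
open import Data.Product using (Σ; _×_; _,_; ∃)
open import Data.Sum using (_⊎_)
open import Data.Empty using (⊥)
open import Function.Bundles using (_⇔_)
open import Relation.Binary.PropositionalEquality using (_≡_)

-- A valuation v : N → {0,1}, with N = {p_1,…,p_n} identified with Fin n.
Valuation : ℕ → Set
Valuation n = Vec Bool n

Team : ℕ → Set
Team n = Valuation n → Bool

_∈T_ : ∀ {n} → Valuation n → Team n → Set
v ∈T s = T (s v)

_⊆T_ : ∀ {n} → Team n → Team n → Set
s ⊆T t = ∀ v → v ∈T s → v ∈T t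

IsEmpty : ∀ {n} → Team n → Set
IsEmpty s = ∀ v → ¬' (v ∈T s)
  where ¬' : Set → Set
        ¬' A = A → ⊥

IsUnion : ∀ {n} → Team n → Team n → Team n → Set
IsUnion s r r' = ∀ v → (v ∈T s) ⇔ ((v ∈T r) ⊎ (v ∈T r'))

data Term (n : ℕ) : Set where
  var : Fin n → Term n
  tt  : Term n
  ff  : Term n

evalTerm : ∀ {n} → Valuation n → Term n → Bool
evalTerm v (var i) = lookup v i
evalTerm v tt = true
evalTerm v ff = false

data Formula (n : ℕ) : Set where
  incl : ∀ {m} → Vec (Term n) m → Vec (Term n) m → Formula n
  bot  : Formula n
  _∨_  : Formula n → Formula n → Formula n

evalTerms : ∀ {n m} → Valuation n → Vec (Term n) m → Vec Bool m
evalTerms v [] = []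
evalTerms v (a ∷ as) = evalTerm v a ∷ evalTerms v as

_⊨_ : ∀ {n} → Team n → Formula n → Set
s ⊨ incl as bs = ∀ v → v ∈T s → Σ (Valuation _) λ u → (u ∈T s) × (evalTerms v as ≡ evalTerms u bs)
s ⊨ bot = IsEmpty s
s ⊨ (φ ∨ ψ) = Σ (Team _) λ r → Σ (Team _) λ r' →
  IsUnion s r r' × (r ⊨ φ) × (r' ⊨ ψ)

allValuations : (n : ℕ) → List (Valuation n)
allValuations zero = [] ∷ []
allValuations (suc n) = map (true ∷_) (allValuations n) ++ map (false ∷_) (allValuations n)

constTerm : ∀ {n} → Bool → Term n
constTerm true = tt
constTerm false = ff

iota : ∀ {n} → Valuation n → Formula n
iota {n} v = incl (Data.Vec.map constTerm v) (tabulate var)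

bigOr : ∀ {n} → List (Formula n) → Formula n
bigOr [] = bot
bigOr (φ ∷ []) = φ
bigOr (φ ∷ φs@(_ ∷ _)) = φ ∨ bigOr φs

sigma : ∀ {n} → Team n → Formula n
sigma {n} t = bigOr (map iota (Data.List.filterᵇ (λ v → not (t v)) (allValuations n)))

{-# OPTIONS --safe #-}
-- On a nonempty team s the atom ι_v holds iff v ∈ s: its right-hand side
-- p_1…p_n ranges over the valuations in s, its left-hand side is constantly v.
-- Hence ⋁_{v ∈ L} ι_v holds on a nonempty s iff s contains some v ∈ L. Going
-- down, the part of the split containing a given element of s contains a member
-- of L; going up, s can be put entirely on a disjunct ι_v with v ∈ s, since the
-- empty team satisfies the other disjuncts. For L = 2^N ∖ t this says s ⊈ t.
module Submission where

open import Defs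
open import Level using (0ℓ)
open import Data.Nat using (ℕ)
open import Data.Bool using (Bool; true; false; T; not)
open import Data.Empty using (⊥-elim)
open import Data.Product using (∃; _,_; proj₂)
open import Data.Sum using (_⊎_; inj₁; inj₂; [_,_]; [_,_]′)
open import Data.Sum.Function.Propositional using (_⊎-⇔_)
open import Data.List using (List; []; _∷_; map; filterᵇ)
open import Data.List.Relation.Unary.Any using (Any; here; there; any?; tail)
import Data.List.Relation.Unary.Any as Any
open import Data.List.Relation.Unary.Any.Properties using (¬Any[])
open import Data.List.Membership.Propositional using (_∈_; find; lose)
open import Data.List.Membership.Propositional.Properties
  using (∈-map⁺; ∈-++⁺ˡ; ∈-++⁺ʳ; ∈-filter⁺; ∈-filter⁻)
open import Data.Vec using (Vec; []; _∷_; tabulate; lookup)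
import Data.Vec as Vec
open import Data.Vec.Properties using (tabulate-∘; tabulate∘lookup)
open import Function using (_∘_; id)
open import Function.Bundles using (_⇔_; mk⇔; Equivalence)
open import Function.Construct.Identity using (⇔-id)
open import Function.Properties.Equivalence using (⇔-setoid)
open import Relation.Nullary using (¬_; Dec; yes; no)
open import Relation.Nullary.Decidable using (T?; toSum; decidable-stable)
open import Relation.Binary.PropositionalEquality
  using (_≡_; refl; sym; trans; cong; cong₂; subst; module ≡-Reasoning)
import Relation.Binary.Reasoning.Setoid as SetoidReasoning

open Equivalence using (to; from)

T-not⇔¬T : ∀ {b} → T (not b) ⇔ (¬ T b)
T-not⇔¬T {true}  = mk⇔ (λ ()) (λ ¬b → ¬b _)
T-not⇔¬T {false} = mk⇔ (λ _ ()) (λ _ → _)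

evalTerms≡map : ∀ {n m} (v : Valuation n) (as : Vec (Term n) m) →
  evalTerms v as ≡ Vec.map (evalTerm v) as
evalTerms≡map v []       = refl
evalTerms≡map v (a ∷ as) = cong (evalTerm v a ∷_) (evalTerms≡map v as)

evalTerm-constTerm : ∀ {n} (v : Valuation n) (b : Bool) → evalTerm v (constTerm b) ≡ b
evalTerm-constTerm v true  = refl
evalTerm-constTerm v false = refl

evalTerms-constTerms : ∀ {n m} (v : Valuation n) (bs : Vec Bool m) →
  evalTerms v (Vec.map constTerm bs) ≡ bs
evalTerms-constTerms v []       = refl
evalTerms-constTerms v (b ∷ bs) = cong₂ _∷_ (evalTerm-constTerm v b) (evalTerms-constTerms v bs)

evalTerms-vars : ∀ {n} (v : Valuation n) → evalTerms v (tabulate var) ≡ v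
evalTerms-vars v = begin
  evalTerms v (tabulate var)          ≡⟨ evalTerms≡map v (tabulate var) ⟩
  Vec.map (evalTerm v) (tabulate var) ≡⟨ tabulate-∘ (evalTerm v) var ⟨
  tabulate (lookup v)                 ≡⟨ tabulate∘lookup v ⟩
  v                                   ∎
  where open ≡-Reasoning

∈-allValuations : ∀ {n} (v : Valuation n) → v ∈ allValuations n
∈-allValuations []          = here refl
∈-allValuations (true ∷ v)  = ∈-++⁺ˡ (∈-map⁺ (true ∷_) (∈-allValuations v))
∈-allValuations (false ∷ v) =
  ∈-++⁺ʳ (map (true ∷_) (allValuations _)) (∈-map⁺ (false ∷_) (∈-allValuations v))

module _ {n : ℕ} where

  NonEmpty : Team n → Set
  NonEmpty s = ∃ (_∈T s)

  ∅ : Team n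
  ∅ _ = false

  IsUnion⇒⊆ˡ : ∀ {s r r' : Team n} → IsUnion s r r' → r ⊆T s
  IsUnion⇒⊆ˡ s≡r∪r' v = from (s≡r∪r' v) ∘ inj₁

  IsUnion⇒⊆ʳ : ∀ {s r r' : Team n} → IsUnion s r r' → r' ⊆T s
  IsUnion⇒⊆ʳ s≡r∪r' v = from (s≡r∪r' v) ∘ inj₂

  IsEmpty⇒⊨ : ∀ {s} → IsEmpty s → (φ : Formula n) → s ⊨ φ
  IsEmpty⇒⊨ s-empty (incl as bs) v v∈s = ⊥-elim (s-empty v v∈s)
  IsEmpty⇒⊨ s-empty bot                = s-empty
  IsEmpty⇒⊨ {s} s-empty (φ ∨ ψ)        =
    s , s , (λ v → mk⇔ inj₁ [ id , id ]) , IsEmpty⇒⊨ s-empty φ , IsEmpty⇒⊨ s-empty ψ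

  ∨-introˡ : ∀ {s} φ ψ → s ⊨ φ → s ⊨ (φ ∨ ψ)
  ∨-introˡ {s} φ ψ s⊨φ = s , ∅ , (λ v → mk⇔ inj₁ [ id , (λ ()) ]) , s⊨φ , IsEmpty⇒⊨ (λ _ ()) ψ

  ∨-introʳ : ∀ {s} φ ψ → s ⊨ ψ → s ⊨ (φ ∨ ψ)
  ∨-introʳ {s} φ ψ s⊨ψ = ∅ , s , (λ v → mk⇔ inj₂ [ (λ ()) , id ]) , IsEmpty⇒⊨ (λ _ ()) φ , s⊨ψ

  ⊨-iota⇔ : (s : Team n) (v : Valuation n) → s ⊨ iota v ⇔ (NonEmpty s → v ∈T s)
  ⊨-iota⇔ s v = mk⇔ ⊨-iota⇒ ⊨-iota⇐
    where
    ⊨-iota⇒ : s ⊨ iota v → NonEmpty s → v ∈T s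
    ⊨-iota⇒ s⊨ι (w , w∈s) with s⊨ι w w∈s
    ... | u , u∈s , ι-matches = subst (_∈T s) (sym v≡u) u∈s
      where
      v≡u : v ≡ u
      v≡u = begin
        v                                  ≡⟨ evalTerms-constTerms w v ⟨
        evalTerms w (Vec.map constTerm v)  ≡⟨ ι-matches ⟩
        evalTerms u (tabulate var)         ≡⟨ evalTerms-vars u ⟩
        u                                  ∎
        where open ≡-Reasoning

    ⊨-iota⇐ : (NonEmpty s → v ∈T s) → s ⊨ iota v
    ⊨-iota⇐ v∈s w w∈s = v , v∈s (w , w∈s) , trans (evalTerms-constTerms w v) (sym (evalTerms-vars v))

  ⊨-⋁iota⇒ : ∀ {s} (L : List (Valuation n)) →
    s ⊨ bigOr (map iota L) → NonEmpty s → Any (_∈T s) L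
  ⊨-⋁iota⇒ []          s-empty (w , w∈s) = ⊥-elim (s-empty w w∈s)
  ⊨-⋁iota⇒ (v ∷ [])    s⊨ι     s≠∅       = here (to (⊨-iota⇔ _ v) s⊨ι s≠∅)
  ⊨-⋁iota⇒ (v ∷ L@(_ ∷ _)) (r , r' , s≡r∪r' , r⊨ι , r'⊨⋁) (w , w∈s) =
    [ (λ w∈r  → here (IsUnion⇒⊆ˡ s≡r∪r' v (to (⊨-iota⇔ r v) r⊨ι (w , w∈r))))
    , (λ w∈r' → there (Any.map (λ {x} → IsUnion⇒⊆ʳ s≡r∪r' x) (⊨-⋁iota⇒ L r'⊨⋁ (w , w∈r'))))
    ] (to (s≡r∪r' w) w∈s)

  ⊨-⋁iota⇐ : ∀ {s} (L : List (Valuation n)) →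
    (NonEmpty s → Any (_∈T s) L) → s ⊨ bigOr (map iota L)
  ⊨-⋁iota⇐ [] meets = λ w w∈s → ¬Any[] (meets (w , w∈s))
  ⊨-⋁iota⇐ {s} (v ∷ []) meets = from (⊨-iota⇔ s v) (Any.head (λ ()) ∘ meets)
  ⊨-⋁iota⇐ {s} (v ∷ L@(_ ∷ _)) meets =
    [ (λ v∈s → ∨-introˡ (iota v) (bigOr (map iota L)) (from (⊨-iota⇔ s v) (λ _ → v∈s)))
    , (λ v∉s → ∨-introʳ (iota v) (bigOr (map iota L)) (⊨-⋁iota⇐ L (tail v∉s ∘ meets)))
    ]′ (toSum (T? (s v)))

  ⊨-⋁iota⇔ : ∀ {s} (L : List (Valuation n)) →
    s ⊨ bigOr (map iota L) ⇔ (NonEmpty s → Any (_∈T s) L)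
  ⊨-⋁iota⇔ L = mk⇔ (⊨-⋁iota⇒ L) (⊨-⋁iota⇐ L)

  valuationsOutside : Team n → List (Valuation n)
  valuationsOutside t = filterᵇ (not ∘ t) (allValuations n)

  meetsOutside⇔⊈ : (s t : Team n) → Any (_∈T s) (valuationsOutside t) ⇔ (¬ s ⊆T t)
  meetsOutside⇔⊈ s t = mk⇔ meets⇒⊈ ⊈⇒meets
    where
    outside? = T? ∘ not ∘ t

    meets⇒⊈ : Any (_∈T s) (valuationsOutside t) → ¬ s ⊆T t
    meets⇒⊈ meets s⊆t with find meets
    ... | v , v∈outside , v∈s =
      to T-not⇔¬T (proj₂ (∈-filter⁻ outside? {xs = allValuations n} v∈outside)) (s⊆t v v∈s)

    ⊈⇒meets : ¬ s ⊆T t → Any (_∈T s) (valuationsOutside t)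
    ⊈⇒meets s⊈t = decidable-stable (any? (T? ∘ s) (valuationsOutside t)) λ ¬meets →
      s⊈t λ v v∈s → decidable-stable (T? (t v)) λ v∉t →
        ¬meets (lose (∈-filter⁺ outside? (∈-allValuations v) (from T-not⇔¬T v∉t)) v∈s)

  NonEmpty⇒-⇔⊎IsEmpty : ∀ {s} {P : Set} → Dec P → (NonEmpty s → P) ⇔ (P ⊎ IsEmpty s)
  NonEmpty⇒-⇔⊎IsEmpty {s} {P} P? = mk⇔ (split P?) join
    where
    split : Dec P → (NonEmpty s → P) → P ⊎ IsEmpty s
    split (yes p) _ = inj₁ p
    split (no ¬p) p = inj₂ λ w w∈s → ¬p (p (w , w∈s))

    join : P ⊎ IsEmpty s → NonEmpty s → P
    join (inj₁ p)       _         = p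
    join (inj₂ s-empty) (w , w∈s) = ⊥-elim (s-empty w w∈s)

mainTheorem6 : (n : ℕ) → (t : Team n) → (∃ λ v → v ∈T t) →
    (s : Team n) → (s ⊨ sigma t) ⇔ ((¬ (s ⊆T t)) ⊎ IsEmpty s)
mainTheorem6 n t _ s = begin
  s ⊨ sigma t                                      ≈⟨ ⊨-⋁iota⇔ (valuationsOutside t) ⟩
  (NonEmpty s → Any (_∈T s) (valuationsOutside t)) ≈⟨ NonEmpty⇒-⇔⊎IsEmpty (any? (T? ∘ s) _) ⟩
  (Any (_∈T s) (valuationsOutside t) ⊎ IsEmpty s)  ≈⟨ meetsOutside⇔⊈ s t ⊎-⇔ ⇔-id _ ⟩
  ((¬ s ⊆T t) ⊎ IsEmpty s)                         ∎
  where open SetoidReasoning (⇔-setoid 0ℓ)
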